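{- The penalties $\mathrm{Pen}(\mathcal{T}_{\mathrm{comp}}^{\mathrm{nodist}}/\mathcal{T}_{\mathrm{comp}}^{\mathrm{dist}})$, $\mathrm{Pen}(\mathcal{T}_{\mathrm{blind}}^{\mathrm{nodist}}/\mathcal{T}_{\mathrm{blind}}^{\mathrm{dist}})$ and $\mathrm{Pen}(\mathcal{T}_{\mathrm{blind}}^{\mathrm{nodist}}/\mathcal{T}_{\mathrm{comp}}^{\mathrm{dist}})$ are all $O(m)$, i.e. $O(f)$ for $f(m)=m$.
   Context: Treasure hunt in trees. A tree is a finite tree rooted at the starting node of a mobile agent; at each node of degree $\delta$ the incident edges carry port numbers $0,\dots,\delta-1$, assigned arbitrarily at each node. $h(T)$ is the depth of $T$. An instance is a pair $(T,d)$ with $T$ a tree and $1\le d\le h(T)$; a knowledge is a set of instances. For a tree $T^*$ and $1\le d^*\le h(T^*)$, let $P(T^*)$ be the set of trees obtained from $T^*$ by reassigning arbitrary port numbers at each node. Knowledge types (each ranging over all trees $T^*$ and admissible $d^*$): $\mathcal{T}_{\mathrm{comp}}^{\mathrm{dist}}$ consists of the sets $\{(T^*,d^*)\}$; $\mathcal{T}_{\mathrm{blind}}^{\mathrm{dist}}$ of the sets $\{(T,d^*):T\in P(T^*)\}$; $\mathcal{T}_{\mathrm{comp}}^{\mathrm{nodist}}$ of the sets $\{(T^*,d):1\le d\le h(T^*)\}$; $\mathcal{T}_{\mathrm{blind}}^{\mathrm{nodist}}$ of the sets $\{(T,d):T\in P(T^*),1\le d\le h(T^*)\}$. A deterministic algorithm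 given knowledge $K$ starts at the root; at each step it sees the port numbers at its current node, chooses one based on its history (initially $K$), traverses the edge and learns the entry port and degree of the new node. The cost $C_{\mathcal{A}}^K(T,d)$ is the number of edge traversals (including revisits) by $\mathcal{A}$ in $T$ until all nodes at distance exactly $d$ from the root are visited. With $B_m(K)=\{(T,d)\in K:d\le m\}$, the overhead is $\mathcal{O}_{\mathcal{A}}^K(m)=\max_{(T,d)\in B_m(K)}C_{\mathcal{A}}^K(T,d)/d$ if $B_m(K)\ne\emptyset$, else $0$. For knowledge types $\mathcal{T}_1\ll\mathcal{T}_2$ (every $K_1\in\mathcal{T}_1$ is contained in some $K_2\in\mathcal{T}_2$) and $f:\mathbb{N}\to\mathbb{N}$, $\mathrm{Pen}(\mathcal{T}_2/\mathcal{T}_1)$ is $O(f)$ if there exist a constant $c>0$ and a deterministic algorithm $\mathcal{A}_2$ such that for every deterministic algorithm $\mathcal{A}_1$, for all $K_2\in\mathcal{T}_2$ and all $m\ge1$: $\mathcal{O}_{\mathcal{A}_2}^{K_2}(m)\le c\cdot f(m)\cdot\max_{K_1\in\mathcal{T}_1,K_1\subseteq K_2}\mathcal{O}_{\mathcal{A}_1}^{K_1}(m)$. -}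

module Defs where

open import Data.Nat using (ℕ; zero; suc; _+_; _*_; _∸_; _≤_; _⊔_; _≡ᵇ_; _<ᵇ_)
open import Data.Fin using (Fin; toℕ)
open import Data.List using (List; []; _∷_; length; map; reverse; _++_)
open import Data.List.Membership.Propositional using (_∈_)
open import Data.Maybe using (Maybe; just; nothing; Is-just)
open import Data.Product using (Σ; ∃-syntax; _×_; _,_; proj₁; proj₂)
open import Data.Unit using (⊤)
open import Data.Bool using (if_then_else_)
open import Relation.Binary.PropositionalEquality using (_≡_)

-- A non-root node is  sub cs p : its children cs are listed in increasing
-- order of their port numbers at this node, and p is the port number (at
-- this node) of the edge to its parent.  The node has degree 1 + length cs;
-- the ports {0..length cs} ∖ {p}, in increasing order, go to cs.
-- The port at the child end of an edge is stored in the child (its p).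
-- A tree (rooted at the agent's start) is the list of the root's children,
-- child i being reached through port i of the root (degree = length).

data Sub : Set where
  sub : (cs : List Sub) → Fin (suc (length cs)) → Sub

PTree : Set
PTree = List Sub

-- Unported rooted trees (ordered children only used as a representative;
-- reassignment of ports is captured by isomorphism _≅_ below).
data Shape : Set where
  mk : List Shape → Shape

mutual
  shapeSub : Sub → Shape
  shapeSub (sub cs _) = mk (shapeList cs)

  shapeList : List Sub → List Shape
  shapeList [] = []
  shapeList (c ∷ cs) = shapeSub c ∷ shapeList cs

shape : PTree → Shape
shape T = mk (shapeList T)

mutual
  hS : Shape → ℕ
  hS (mk xs) = hL xs

  hL : List Shape → ℕ
  hL [] = 0
  hL (x ∷ xs) = suc (hS x) ⊔ hL xs

h : PTree → ℕ
h T = hS (shape T)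

-- rooted-tree isomorphism (children form a multiset)
mutual
  data _≅_ : Shape → Shape → Set where
    mk : ∀ {xs ys} → xs ≅L ys → mk xs ≅ mk ys

  data _≅L_ : List Shape → List Shape → Set where
    []  : [] ≅L []
    ins : ∀ {x xs y} ys₁ ys₂ → x ≅ y → xs ≅L (ys₁ ++ ys₂) →
          (x ∷ xs) ≅L (ys₁ ++ y ∷ ys₂)

-- T ∈ P(S): T is S with some port assignment
InP : PTree → Shape → Set
InP T S = shape T ≅ S

-- Navigation.  A position is the reversed path of child indices from
-- the root (head = index of the current node among its parent's children).

lookupM : ∀ {A : Set} → List A → ℕ → Maybe A
lookupM [] _ = nothing
lookupM (x ∷ xs) zero = just x
lookupM (x ∷ xs) (suc n) = lookupM xs n

mutual
  getSub : List Sub → List ℕ → Maybe Sub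
  getSub cs [] = nothing
  getSub cs (i ∷ is) with lookupM cs i
  ... | nothing = nothing
  ... | just s = descend s is

  descend : Sub → List ℕ → Maybe Sub
  descend s [] = just s
  descend (sub cs _) (j ∷ js) = getSub cs (j ∷ js)

Pos : Set
Pos = List ℕ

IsNode : PTree → Pos → Set
IsNode T [] = ⊤
IsNode T (i ∷ r) = Is-just (getSub T (reverse (i ∷ r)))

subDeg : Maybe Sub → ℕ
subDeg nothing = 0
subDeg (just (sub cs _)) = suc (length cs)

deg : PTree → Pos → ℕ
deg T [] = length T
deg T (i ∷ r) = subDeg (getSub T (reverse (i ∷ r)))

enterChild : List Sub → ℕ → Pos → Maybe (Pos × ℕ)
enterChild cs j rp with lookupM cs j
... | nothing = nothing
... | just (sub _ p') = just (j ∷ rp , toℕ p')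

-- taking port q at position rp: new position and entry port
-- (nothing if q is not a valid port)
move : PTree → Pos → ℕ → Maybe (Pos × ℕ)
move T [] q = enterChild T q []
move T (i ∷ r) q with getSub T (reverse (i ∷ r))
... | nothing = nothing
... | just (sub cs p) =
  if q ≡ᵇ toℕ p then just (r , i)
  else enterChild cs (if q <ᵇ toℕ p then q else q ∸ 1) (i ∷ r)

-- Deterministic exploration.
-- History: degree of the root, and (most recent first) the list of
-- (chosen port, entry port, degree of the node entered).
Hist : Set
Hist = ℕ × List (ℕ × ℕ × ℕ)

-- A strategy chooses a port from the history; choosing a port that does
-- not exist at the current node means the agent stops for ever.
Strategy : Set
Strategy = Hist → ℕ

exec : Strategy → PTree → ℕ → Pos → Hist → List Pos
exec σ T zero pos hs = pos ∷ []
exec σ T (suc n) pos hs with move T pos (σ hs)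
... | nothing = pos ∷ []
... | just (pos' , e) =
  pos ∷ exec σ T n pos' (proj₁ hs , (σ hs , e , deg T pos') ∷ proj₂ hs)

visited : Strategy → PTree → ℕ → List Pos
visited σ T t = exec σ T t [] (length T , [])

-- "cost ≤ t": all nodes at distance exactly d visited within t traversals
Done : Strategy → PTree → ℕ → ℕ → Set
Done σ T d t = ∀ rp → length rp ≡ d → IsNode T rp → rp ∈ visited σ T t

-- Knowledge types: a parameter type (one value per knowledge K of the
-- type) and membership of instances (T , d) in K.

record KType : Set₁ where
  field
    Param : Set
    Mem   : Param → PTree → ℕ → Set
open KType public

compDist : KType
compDist = record
  { Param = Σ (PTree × ℕ) (λ Td → 1 ≤ proj₂ Td × proj₂ Td ≤ h (proj₁ Td))
  ; Mem = λ k T d → T ≡ proj₁ (proj₁ k) × d ≡ proj₂ (proj₁ k) }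

blindDist : KType
blindDist = record
  { Param = Σ (Shape × ℕ) (λ Sd → 1 ≤ proj₂ Sd × proj₂ Sd ≤ hS (proj₁ Sd))
  ; Mem = λ k T d → InP T (proj₁ (proj₁ k)) × d ≡ proj₂ (proj₁ k) }

compNodist : KType
compNodist = record
  { Param = PTree
  ; Mem = λ T* T d → T ≡ T* × 1 ≤ d × d ≤ h T* }

blindNodist : KType
blindNodist = record
  { Param = Shape
  ; Mem = λ S T d → InP T S × 1 ≤ d × d ≤ hS S }

Alg : KType → Set
Alg K = Param K → Strategy

-- Overhead of A on knowledge k at m is ≤ num / den  (den ≥ 1):
-- every (T,d) ∈ B_m(k) has cost C with C ≤ (num/den)·d.
OverheadLe : (K : KType) → Alg K → Param K → ℕ → ℕ → ℕ → Set
OverheadLe K A k m num den =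
  ∀ T d → Mem K k T d → d ≤ m →
  ∃[ t ] (t * den ≤ num * d × Done (A k) T d t)

-- Pen(K2 / K1) is O(f).  "O ≤ c·f(m)·max_{K1 ⊆ K2} O'" is expressed as:
-- for every rational bound num/den of all O'_{A1}^{K1}(m) with K1 ⊆ K2,
-- O_{A2}^{K2}(m) ≤ c·f(m)·num/den.
PenO : (K1 K2 : KType) → (ℕ → ℕ) → Set
PenO K1 K2 f =
  ∃[ c ] (1 ≤ c × Σ (Alg K2) λ A2 →
    ∀ (A1 : Alg K1) (k2 : Param K2) (m : ℕ) → 1 ≤ m →
    ∀ num den → 1 ≤ den →
    (∀ (k1 : Param K1) →
       (∀ T d → Mem K1 k1 T d → Mem K2 k2 T d) →
       OverheadLe K1 A1 k1 m num den) →
    OverheadLe K2 A2 k2 m (c * f m * num) den)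

{-# OPTIONS --safe #-}
module Submission where

open import Defs
open import Data.Bool using (Bool; true; false; if_then_else_; T; _∧_)
open import Data.Bool.Properties using (∧-zeroʳ)
open import Data.Empty using (⊥-elim)
open import Data.Fin using (toℕ)
open import Data.List using (List; []; _∷_; [_]; length; map; reverse; _++_; _ʳ++_)
open import Data.List.Properties
  using (∷-injectiveʳ; length-++; length-map; length-reverse; reverse-involutive; reverse-injective; unfold-reverse)
open import Data.List.Membership.Propositional using (_∈_)
open import Data.List.Membership.Propositional.Properties using (∈-++⁺ˡ; ∈-++⁺ʳ; ∈-++⁻; ∈-∃++; ∈-map⁻)
open import Data.List.Relation.Unary.Any using (here; there)
open import Data.List.Relation.Unary.All using ([])
open import Data.List.Relation.Unary.Unique.Propositional using (Unique; []; _∷_)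
import Data.List.Relation.Unary.Unique.Propositional.Properties as Unique
open import Data.Maybe using (Maybe; just; nothing; Is-just)
open import Data.Maybe.Relation.Unary.Any using (just)
open import Data.Nat using (ℕ; zero; suc; _+_; _*_; _^_; _≤_; _<_; _⊔_; _≡ᵇ_; _<ᵇ_; z≤n; s≤s; pred; _≤?_; _<?_)
open import Data.Nat.Properties
open import Data.Nat.Tactic.RingSolver using (solve-∀)
open import Data.Product using (∃-syntax; _×_; _,_; proj₁; proj₂; map₂)
open import Data.Sum using (inj₁; inj₂)
open import Data.Unit using (tt)
open import Relation.Nullary using (¬_; yes; no)
open import Relation.Binary.PropositionalEquality
  using (_≡_; _≢_; refl; sym; trans; cong; cong₂; subst; module ≡-Reasoning)

-- Without the distance d, explore by iterated depth-first search: if a is the root degree, phase k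
-- searches the deepest ball with at most a·2^k non-root nodes, at cost at most 2a·2^k.  The costs
-- grow geometrically, so by the first phase reaching depth d the total cost is O(a + n), where n is
-- the number of non-root nodes within distance d.
-- Conversely, an algorithm that knows the distance j must visit every node of level j, so if its
-- overhead is at most r on all distances j ≤ m, every level up to m has at most r·m nodes; hence
-- a ≤ r·m and n ≤ d·r·m, and the iterated search has overhead at most 10·m·r.

-- Counting nodes by depth

children : Shape → List Shape
children (mk xs) = xs

-- The roots of the forest have depth 1.
nodesUpTo : ℕ → List Shape → ℕ
nodesUpTo zero    _            = 0
nodesUpTo (suc b) []           = 0
nodesUpTo (suc b) (mk ys ∷ xs) = suc (nodesUpTo b ys) + nodesUpTo (suc b) xs

rootDegree : Shape → ℕ
rootDegree S = nodesUpTo 1 (children S)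

nodesUpTo-++ : ∀ b xs ys → nodesUpTo b (xs ++ ys) ≡ nodesUpTo b xs + nodesUpTo b ys
nodesUpTo-++ zero    xs           ys = refl
nodesUpTo-++ (suc b) []           ys = refl
nodesUpTo-++ (suc b) (mk zs ∷ xs) ys =
  trans (cong (suc (nodesUpTo b zs) +_) (nodesUpTo-++ (suc b) xs ys))
        (sym (+-assoc (suc (nodesUpTo b zs)) _ _))

nodesUpTo-≅L : ∀ b {xs ys} → xs ≅L ys → nodesUpTo b xs ≡ nodesUpTo b ys
nodesUpTo-≅L b       []            = refl
nodesUpTo-≅L zero    (ins _ _ _ _) = refl
nodesUpTo-≅L (suc b) (ins {x = mk xs′} {xs} {mk ys′} ys₁ ys₂ (mk x≅y) xs≅ys) = begin
  suc (nodesUpTo b xs′) + nodesUpTo (suc b) xs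
    ≡⟨ cong₂ (λ u v → suc u + v) (nodesUpTo-≅L b x≅y) (nodesUpTo-≅L (suc b) xs≅ys) ⟩
  suc (nodesUpTo b ys′) + nodesUpTo (suc b) (ys₁ ++ ys₂)
    ≡⟨ cong (suc (nodesUpTo b ys′) +_) (nodesUpTo-++ (suc b) ys₁ ys₂) ⟩
  suc (nodesUpTo b ys′) + (nodesUpTo (suc b) ys₁ + nodesUpTo (suc b) ys₂)
    ≡⟨ x+[y+z]≡y+[x+z] (suc (nodesUpTo b ys′)) (nodesUpTo (suc b) ys₁) (nodesUpTo (suc b) ys₂) ⟩
  nodesUpTo (suc b) ys₁ + (suc (nodesUpTo b ys′) + nodesUpTo (suc b) ys₂)
    ≡⟨ sym (nodesUpTo-++ (suc b) ys₁ (mk ys′ ∷ ys₂)) ⟩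
  nodesUpTo (suc b) (ys₁ ++ mk ys′ ∷ ys₂)
    ∎
  where
  open ≡-Reasoning
  x+[y+z]≡y+[x+z] : ∀ x y z → x + (y + z) ≡ y + (x + z)
  x+[y+z]≡y+[x+z] = solve-∀

nodesUpTo-≅ : ∀ b {x y} → x ≅ y → nodesUpTo b (children x) ≡ nodesUpTo b (children y)
nodesUpTo-≅ b (mk xs≅ys) = nodesUpTo-≅L b xs≅ys

hL-++ : ∀ xs ys → hL (xs ++ ys) ≡ hL xs ⊔ hL ys
hL-++ []       ys = refl
hL-++ (x ∷ xs) ys = trans (cong (suc (hS x) ⊔_) (hL-++ xs ys)) (sym (⊔-assoc (suc (hS x)) (hL xs) (hL ys)))

mutual
  hS-≅ : ∀ {x y} → x ≅ y → hS x ≡ hS y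
  hS-≅ (mk xs≅ys) = hL-≅L xs≅ys

  hL-≅L : ∀ {xs ys} → xs ≅L ys → hL xs ≡ hL ys
  hL-≅L [] = refl
  hL-≅L (ins {x} {xs} {y} ys₁ ys₂ x≅y xs≅ys) = begin
    suc (hS x) ⊔ hL xs             ≡⟨ cong₂ (λ u v → suc u ⊔ v) (hS-≅ x≅y) (trans (hL-≅L xs≅ys) (hL-++ ys₁ ys₂)) ⟩
    suc (hS y) ⊔ (hL ys₁ ⊔ hL ys₂) ≡⟨ sym (⊔-assoc (suc (hS y)) (hL ys₁) (hL ys₂)) ⟩
    (suc (hS y) ⊔ hL ys₁) ⊔ hL ys₂ ≡⟨ cong (_⊔ hL ys₂) (⊔-comm (suc (hS y)) (hL ys₁)) ⟩
    (hL ys₁ ⊔ suc (hS y)) ⊔ hL ys₂ ≡⟨ ⊔-assoc (hL ys₁) (suc (hS y)) (hL ys₂) ⟩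
    hL ys₁ ⊔ (suc (hS y) ⊔ hL ys₂) ≡⟨ sym (hL-++ ys₁ (y ∷ ys₂)) ⟩
    hL (ys₁ ++ y ∷ ys₂)            ∎
    where open ≡-Reasoning

mutual
  ≅-refl : ∀ {x} → x ≅ x
  ≅-refl {mk xs} = mk ≅L-refl

  ≅L-refl : ∀ {xs} → xs ≅L xs
  ≅L-refl {[]}     = []
  ≅L-refl {x ∷ xs} = ins [] xs ≅-refl ≅L-refl

rootDegree-pos : ∀ S → 1 ≤ hS S → 1 ≤ rootDegree S
rootDegree-pos (mk [])         ()
rootDegree-pos (mk (mk _ ∷ _)) _ = s≤s z≤n

nodesUpTo-pos : ∀ d T → 1 ≤ d → 1 ≤ length T → 1 ≤ nodesUpTo d (shapeList T)
nodesUpTo-pos (suc _) (sub _ _ ∷ _) _ _ = s≤s z≤n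

≅-nonempty : ∀ T {S} → shape T ≅ S → 1 ≤ hS S → 1 ≤ length T
≅-nonempty []      T≅S 1≤h = ⊥-elim (<⇒≢ 1≤h (hS-≅ T≅S))
≅-nonempty (_ ∷ _) _   _   = s≤s z≤n

≡ᵇ-refl : ∀ n → (n ≡ᵇ n) ≡ true
≡ᵇ-refl zero    = refl
≡ᵇ-refl (suc n) = ≡ᵇ-refl n

≢⇒≡ᵇ≡false : ∀ {m n} → m ≢ n → (m ≡ᵇ n) ≡ false
≢⇒≡ᵇ≡false {m} {n} m≢n with m ≡ᵇ n in eq
... | false = refl
... | true  = ⊥-elim (m≢n (≡ᵇ⇒≡ m n (subst T (sym eq) tt)))

<⇒<ᵇ≡true : ∀ {m n} → m < n → (m <ᵇ n) ≡ true
<⇒<ᵇ≡true {m} {n} m<n with m <ᵇ n | <⇒<ᵇ m<n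
... | true | _ = refl

≥⇒<ᵇ≡false : ∀ {m n} → n ≤ m → (m <ᵇ n) ≡ false
≥⇒<ᵇ≡false {m} {n} n≤m with m <ᵇ n in eq
... | false = refl
... | true  = ⊥-elim (≤⇒≯ n≤m (<ᵇ⇒< m n (subst T (sym eq) tt)))

Is-just⇒≡just : ∀ {A : Set} {m : Maybe A} → Is-just m → ∃[ x ] m ≡ just x
Is-just⇒≡just (just _) = _ , refl

lookupM-< : ∀ {A : Set} (xs : List A) j {x} → lookupM xs j ≡ just x → j < length xs
lookupM-< (_ ∷ _)  zero    _  = s≤s z≤n
lookupM-< (_ ∷ xs) (suc j) eq = s≤s (lookupM-< xs j eq)

mutual
  getSub-∷ʳ : ∀ cs fp {cs′ p j c} → getSub cs fp ≡ just (sub cs′ p) → lookupM cs′ j ≡ just c →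
              getSub cs (fp ++ [ j ]) ≡ just c
  getSub-∷ʳ cs (i ∷ is) eq l with lookupM cs i
  ... | just s = descend-∷ʳ s is eq l

  descend-∷ʳ : ∀ s fp {cs′ p j c} → descend s fp ≡ just (sub cs′ p) → lookupM cs′ j ≡ just c →
               descend s (fp ++ [ j ]) ≡ just c
  descend-∷ʳ (sub cs′ p) []       {j = j} refl l with lookupM cs′ j | l
  ... | just _ | refl = refl
  descend-∷ʳ (sub cs q)  (k ∷ ks) eq l = getSub-∷ʳ cs (k ∷ ks) eq l

getSub-∷⁻ : ∀ cs k fp {s} → getSub cs (k ∷ fp) ≡ just s →
            ∃[ c ] lookupM cs k ≡ just c × descend c fp ≡ just s
getSub-∷⁻ cs k fp eq with lookupM cs k
... | just c = c , refl , eq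

getSub-singleton : ∀ cs j {c} → lookupM cs j ≡ just c → getSub cs [ j ] ≡ just c
getSub-singleton cs j l with lookupM cs j | l
... | just _ | refl = refl

-- pp is the port of the parent edge; at the root it is taken to be the degree, so that there child j
-- is behind port j.
portOf : ℕ → ℕ → ℕ
portOf pp j = if j <ᵇ pp then j else suc j

AtNode : PTree → Pos → List Sub → ℕ → Set
AtNode T []      cs pp = cs ≡ T × pp ≡ length T
AtNode T (i ∷ r) cs pp = ∃[ p ] getSub T (reverse (i ∷ r)) ≡ just (sub cs p) × pp ≡ toℕ p
move-toChild : ∀ T pos {cs pp} j {cs′ p′} → AtNode T pos cs pp → lookupM cs j ≡ just (sub cs′ p′) →
               move T pos (portOf pp j) ≡ just (j ∷ pos , toℕ p′) × AtNode T (j ∷ pos) cs′ (toℕ p′)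
move-toChild T [] {cs} j {p′ = p′} (refl , refl) l = moved , p′ , getSub-singleton T j l , refl
  where
  moved : move T [] (portOf (length T) j) ≡ just (j ∷ [] , toℕ p′)
  moved rewrite <⇒<ᵇ≡true (lookupM-< T j l) | l = refl
move-toChild T (i ∷ r) {cs} j {p′ = p′} (p , at , refl) l =
  moved , p′ , trans (cong (getSub T) (unfold-reverse j (i ∷ r))) (getSub-∷ʳ T (reverse (i ∷ r)) at l) , refl
  where
  entered : enterChild cs j (i ∷ r) ≡ just (j ∷ i ∷ r , toℕ p′)
  entered rewrite l = refl
  moved : move T (i ∷ r) (portOf (toℕ p) j) ≡ just (j ∷ i ∷ r , toℕ p′)
  moved rewrite at with j <? toℕ p
  ... | yes j<p rewrite <⇒<ᵇ≡true j<p | ≢⇒≡ᵇ≡false (<⇒≢ j<p) | <⇒<ᵇ≡true j<p = entered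
  ... | no  j≮p rewrite ≥⇒<ᵇ≡false (≮⇒≥ j≮p)
                      | ≢⇒≡ᵇ≡false {suc j} {toℕ p} (λ eq → j≮p (subst (j <_) eq ≤-refl))
                      | ≥⇒<ᵇ≡false {suc j} {toℕ p} (m≤n⇒m≤1+n (≮⇒≥ j≮p)) = entered

move-toParent : ∀ T i r {cs pp} → AtNode T (i ∷ r) cs pp → move T (i ∷ r) pp ≡ just (r , i)
move-toParent T i r (p , at , refl) rewrite at | ≡ᵇ-refl (toℕ p) = refl

deg-AtNode : ∀ T i r {cs pp} → AtNode T (i ∷ r) cs pp → deg T (i ∷ r) ≡ suc (length cs)
deg-AtNode T i r (_ , at , _) rewrite at = refl

-- Levels and the lower bound

bumpHead : List ℕ → List ℕ
bumpHead []      = []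
bumpHead (i ∷ r) = suc i ∷ r

-- Paths to the nodes at depth j of a forest (resp. below a node), as child indices read from the top,
-- i.e. the reverse of positions.
mutual
  level : ℕ → List Sub → List (List ℕ)
  level zero    _        = []
  level (suc j) []       = []
  level (suc j) (c ∷ cs) = map (0 ∷_) (levelBelow j c) ++ map bumpHead (level (suc j) cs)

  levelBelow : ℕ → Sub → List (List ℕ)
  levelBelow zero    _          = [ [] ]
  levelBelow (suc j) (sub cs _) = level (suc j) cs

getSub-bumpHead : ∀ c cs i q → getSub (c ∷ cs) (suc i ∷ q) ≡ getSub cs (i ∷ q)
getSub-bumpHead c cs i q with lookupM cs i
... | nothing = refl
... | just _  = refl

mutual
  level-sound : ∀ j cs {fp} → fp ∈ level j cs → (∃[ s ] getSub cs fp ≡ just s) × length fp ≡ j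
  level-sound (suc j) (c ∷ cs) fp∈ with ∈-++⁻ (map (0 ∷_) (levelBelow j c)) fp∈
  ... | inj₁ fp∈₁ with ∈-map⁻ (0 ∷_) fp∈₁
  ...   | q , q∈ , refl = map₂ (cong suc) (levelBelow-sound j c q∈)
  level-sound (suc j) (c ∷ cs) fp∈ | inj₂ fp∈₂ with ∈-map⁻ bumpHead fp∈₂
  ... | []    , q∈ , refl with level-sound (suc j) cs q∈
  ...   | (_ , ()) , _
  level-sound (suc j) (c ∷ cs) fp∈ | inj₂ fp∈₂ | i ∷ q , q∈ , refl with level-sound (suc j) cs q∈
  ...   | (s , at) , len = (s , trans (getSub-bumpHead c cs i q) at) , len

  levelBelow-sound : ∀ j c {q} → q ∈ levelBelow j c → (∃[ s ] descend c q ≡ just s) × length q ≡ j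
  levelBelow-sound zero    c           (here refl) = (c , refl) , refl
  levelBelow-sound (suc j) (sub cs _) {[]}    q∈ with level-sound (suc j) cs q∈
  ... | (_ , ()) , _
  levelBelow-sound (suc j) (sub cs _) {_ ∷ _} q∈ = level-sound (suc j) cs q∈

bumpHead-injective : ∀ {x y} → bumpHead x ≡ bumpHead y → x ≡ y
bumpHead-injective {[]}    {[]}     _    = refl
bumpHead-injective {_ ∷ _} {_ ∷ _}  refl = refl

mutual
  level-unique : ∀ j cs → Unique (level j cs)
  level-unique zero    _        = []
  level-unique (suc j) []       = []
  level-unique (suc j) (c ∷ cs) =
    Unique.++⁺ (Unique.map⁺ ∷-injectiveʳ (levelBelow-unique j c))
               (Unique.map⁺ bumpHead-injective (level-unique (suc j) cs))
               disjoint
    where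
    disjoint : ∀ {fp} → ¬ (fp ∈ map (0 ∷_) (levelBelow j c) × fp ∈ map bumpHead (level (suc j) cs))
    disjoint (fp∈₁ , fp∈₂) with ∈-map⁻ (0 ∷_) fp∈₁ | ∈-map⁻ bumpHead fp∈₂
    ... | _ , _ , refl | []    , _ , ()
    ... | _ , _ , refl | _ ∷ _ , _ , ()

  levelBelow-unique : ∀ j c → Unique (levelBelow j c)
  levelBelow-unique zero    _          = [] ∷ []
  levelBelow-unique (suc j) (sub cs _) = level-unique (suc j) cs

Unique⊆⇒length≤ : ∀ {A : Set} {xs ys : List A} → Unique xs → (∀ {x} → x ∈ xs → x ∈ ys) →
                  length xs ≤ length ys
Unique⊆⇒length≤ []  _ = z≤n
Unique⊆⇒length≤ {xs = x ∷ xs} u@(_ ∷ uxs) xs⊆ys with ∈-∃++ (xs⊆ys (here refl))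
... | ys₁ , ys₂ , refl = begin
  suc (length xs)               ≤⟨ s≤s (Unique⊆⇒length≤ uxs xs⊆ys₁ys₂) ⟩
  suc (length (ys₁ ++ ys₂))     ≡⟨ cong suc (length-++ ys₁) ⟩
  suc (length ys₁ + length ys₂) ≡⟨ sym (+-suc (length ys₁) (length ys₂)) ⟩
  length ys₁ + length (x ∷ ys₂) ≡⟨ sym (length-++ ys₁) ⟩
  length (ys₁ ++ x ∷ ys₂)       ∎
  where
  open ≤-Reasoning
  xs⊆ys₁ys₂ : ∀ {z} → z ∈ xs → z ∈ ys₁ ++ ys₂
  xs⊆ys₁ys₂ z∈ with ∈-++⁻ ys₁ (xs⊆ys (there z∈))
  ... | inj₁ z∈ys₁         = ∈-++⁺ˡ z∈ys₁
  ... | inj₂ (here refl)   = ⊥-elim (Unique.Unique[x∷xs]⇒x∉xs u z∈)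
  ... | inj₂ (there z∈ys₂) = ∈-++⁺ʳ ys₁ z∈ys₂

exec-length : ∀ σ T n pos hs → ∃[ rest ] exec σ T n pos hs ≡ pos ∷ rest × length rest ≤ n
exec-length σ T zero    pos hs = [] , refl , z≤n
exec-length σ T (suc n) pos hs with move T pos (σ hs)
... | nothing        = [] , refl , z≤n
... | just (pos′ , e) with exec-length σ T n pos′ (proj₁ hs , (σ hs , e , deg T pos′) ∷ proj₂ hs)
...   | rest , eq , len = _ , refl , subst (λ xs → length xs ≤ suc n) (sym eq) (s≤s len)

getSub⇒IsNode : ∀ T rp {s} → getSub T (reverse rp) ≡ just s → IsNode T rp
getSub⇒IsNode T (x ∷ r) eq rewrite eq = just tt

-- Each step visits at most one new node, and the nodes of a level are distinct.
Done⇒level≤ : ∀ σ T j t → 1 ≤ j → Done σ T j t → length (level j T) ≤ t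
Done⇒level≤ σ T j t 1≤j done with exec-length σ T t [] (length T , [])
... | rest , eq , len = begin
  length (level j T)               ≡⟨ sym (length-map reverse (level j T)) ⟩
  length (map reverse (level j T)) ≤⟨ Unique⊆⇒length≤ (Unique.map⁺ reverse-injective (level-unique j T)) ⊆rest ⟩
  length rest                      ≤⟨ len ⟩
  t                                ∎
  where
  open ≤-Reasoning
  ⊆rest : ∀ {rp} → rp ∈ map reverse (level j T) → rp ∈ rest
  ⊆rest rp∈ with ∈-map⁻ reverse rp∈
  ... | fp , fp∈ , refl with level-sound j T fp∈
  ...   | (_ , at) , len-fp
    with subst (reverse fp ∈_) eq
           (done (reverse fp) (trans (length-reverse fp) len-fp)
                 (getSub⇒IsNode T (reverse fp) (trans (cong (getSub T) (reverse-involutive fp)) at)))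
  ...     | there rp∈rest = rp∈rest
  ...     | here fp≡[] = ⊥-elim (<⇒≢ 1≤j (trans (cong length (sym fp≡[])) (trans (length-reverse fp) len-fp)))

length-level-∷ : ∀ j c cs → length (level (suc j) (c ∷ cs)) ≡ length (levelBelow j c) + length (level (suc j) cs)
length-level-∷ j c cs = trans (length-++ (map (0 ∷_) (levelBelow j c)))
  (cong₂ _+_ (length-map (0 ∷_) (levelBelow j c)) (length-map bumpHead (level (suc j) cs)))

nodesUpTo-suc : ∀ b cs → nodesUpTo (suc b) (shapeList cs) ≡ nodesUpTo b (shapeList cs) + length (level (suc b) cs)
nodesUpTo-suc zero    []             = refl
nodesUpTo-suc (suc b) []             = refl
nodesUpTo-suc zero    (sub _ _ ∷ cs) =
  cong suc (trans (nodesUpTo-suc zero cs) (sym (length-map bumpHead (level 1 cs))))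
nodesUpTo-suc (suc b) (sub cs′ p ∷ cs) = begin
  suc (nodesUpTo (suc b) (shapeList cs′)) + nodesUpTo (suc (suc b)) (shapeList cs)
    ≡⟨ cong₂ (λ u v → suc u + v) (nodesUpTo-suc b cs′) (nodesUpTo-suc (suc b) cs) ⟩
  suc (N′ + L′) + (N + L)
    ≡⟨ regroup N′ L′ N L ⟩
  (suc N′ + N) + (L′ + L)
    ≡⟨ cong ((suc N′ + N) +_) (sym (length-level-∷ (suc b) (sub cs′ p) cs)) ⟩
  nodesUpTo (suc b) (shapeList (sub cs′ p ∷ cs)) + length (level (suc (suc b)) (sub cs′ p ∷ cs))
    ∎
  where
  open ≡-Reasoning
  N′ = nodesUpTo b (shapeList cs′)
  L′ = length (level (suc b) cs′)
  N  = nodesUpTo (suc b) (shapeList cs)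
  L  = length (level (suc (suc b)) cs)
  regroup : ∀ a b c d → suc (a + b) + (c + d) ≡ (suc a + c) + (b + d)
  regroup = solve-∀

nodesUpTo-bound : ∀ T d den x → (∀ j → 1 ≤ j → j ≤ d → length (level j T) * den ≤ x) →
                  nodesUpTo d (shapeList T) * den ≤ d * x
nodesUpTo-bound T zero    den x _      = z≤n
nodesUpTo-bound T (suc d) den x levels = begin
  nodesUpTo (suc d) (shapeList T) * den  ≡⟨ cong (_* den) (nodesUpTo-suc d T) ⟩
  (N + L) * den                          ≡⟨ *-distribʳ-+ den N L ⟩
  N * den + L * den                      ≤⟨ +-mono-≤ below (levels (suc d) (s≤s z≤n) ≤-refl) ⟩
  d * x + x                              ≡⟨ +-comm (d * x) x ⟩
  suc d * x                              ∎
  where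
  open ≤-Reasoning
  N = nodesUpTo d (shapeList T)
  L = length (level (suc d) T)
  below : N * den ≤ d * x
  below = nodesUpTo-bound T d den x (λ j 1≤j j≤d → levels j 1≤j (m≤n⇒m≤1+n j≤d))

levelSize-bound : ∀ σ T {j t m num den} → 1 ≤ j → j ≤ m → t * den ≤ num * j → Done σ T j t →
                  length (level j T) * den ≤ num * m
levelSize-bound σ T {j} {t} {m} {num} {den} 1≤j j≤m t≤ done = begin
  length (level j T) * den ≤⟨ *-monoˡ-≤ den (Done⇒level≤ σ T j t 1≤j done) ⟩
  t * den                  ≤⟨ t≤ ⟩
  num * j                  ≤⟨ *-monoʳ-≤ num j≤m ⟩
  num * m                  ∎
  where open ≤-Reasoning

-- Iterated depth-first search

Covers : PTree → ℕ → List Pos → Set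
Covers T b W = ∀ rp → 1 ≤ length rp → length rp ≤ b → IsNode T rp → rp ∈ W

-- A frame (pp , j , n) belongs to a node with parent port pp (its degree, at the root) and n children,
-- of which those with index < j are explored.  The stack holds the frames of the ancestors, so its
-- length is the depth of the current node.
Frame : Set
Frame = ℕ × ℕ × ℕ

record Explorer : Set where
  constructor ⟨_∣_∣_⟩
  field
    phase : ℕ
    top   : Frame
    stack : List Frame

-- Phase k is a depth-first search of the ball of radius D k.  The strategy recomputes its state
-- from the history.
module IDFS (D : ℕ → ℕ) where

  descends : Explorer → Bool
  descends ⟨ k ∣ (_ , j , n) ∣ R ⟩ = (length R <ᵇ D k) ∧ (j <ᵇ n)

  -- At the root, a finished phase is followed at once, without moving, by the next one.
  settle : Explorer → Explorer
  settle s@(⟨ k ∣ (_ , _ , n) ∣ [] ⟩) = if descends s then s else ⟨ suc k ∣ (n , 0 , n) ∣ [] ⟩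
  settle s@(⟨ _ ∣ _ ∣ _ ∷ _ ⟩)        = s

  settle-descends : ∀ s → descends s ≡ true → settle s ≡ s
  settle-descends ⟨ _ ∣ (_ , _ , _) ∣ [] ⟩ down rewrite down = refl
  settle-descends ⟨ _ ∣ _ ∣ _ ∷ _ ⟩        _    = refl

  -- At the root pp is the degree, not a valid port: an agent that cannot descend there stops.
  port : Explorer → ℕ
  port s@(⟨ _ ∣ (pp , j , _) ∣ _ ⟩) = if descends s then portOf pp j else pp

  pop : Explorer → Explorer
  pop ⟨ k ∣ f ∣ [] ⟩    = ⟨ k ∣ f ∣ [] ⟩
  pop ⟨ k ∣ _ ∣ f ∷ R ⟩ = ⟨ k ∣ f ∣ R ⟩

  observe : Explorer → ℕ → ℕ → Explorer
  observe s@(⟨ k ∣ (pp , j , n) ∣ R ⟩) e δ =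
    if descends s then ⟨ k ∣ (e , 0 , pred δ) ∣ (pp , suc j , n) ∷ R ⟩ else pop s

  replay : Hist → Explorer
  replay (r , [])               = ⟨ 0 ∣ (r , 0 , r) ∣ [] ⟩
  replay (r , (_ , e , δ) ∷ xs) = observe (settle (replay (r , xs))) e δ

  strategy : Strategy
  strategy hs = port (settle (replay hs))

  Config : Set
  Config = Pos × Explorer

  act : PTree → Pos → Explorer → Maybe Config
  act T pos s with move T pos (port s)
  ... | nothing         = nothing
  ... | just (pos′ , e) = just (pos′ , observe s e (deg T pos′))

  step : PTree → Config → Maybe Config
  step T (pos , s) = act T pos (settle s)

  positions : PTree → ℕ → Config → List Pos
  positions T zero    c = [ proj₁ c ]
  positions T (suc n) c with step T c
  ... | nothing = [ proj₁ c ]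
  ... | just c′ = proj₁ c ∷ positions T n c′

  exec≡positions : ∀ T n pos hs → exec strategy T n pos hs ≡ positions T n (pos , replay hs)
  exec≡positions T zero    pos hs = refl
  exec≡positions T (suc n) pos hs with move T pos (port (settle (replay hs)))
  ... | nothing         = refl
  ... | just (pos′ , e) = cong (pos ∷_) (exec≡positions T n pos′ _)

  -- Run T n c c′ W: n steps lead from c to c′, visiting the positions W (without the last one).
  data Run (T : PTree) : ℕ → Config → Config → List Pos → Set where
    []  : ∀ {c} → Run T 0 c c []
    _∷_ : ∀ {n c c′ c″ W} → step T c ≡ just c′ → Run T n c′ c″ W → Run T (suc n) c c″ (proj₁ c ∷ W)

  Run-++ : ∀ {T m n c c′ c″ V W} → Run T m c c′ V → Run T n c′ c″ W → Run T (m + n) c c″ (V ++ W)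
  Run-++ []        r = r
  Run-++ (s ∷ r₁) r₂ = s ∷ Run-++ r₁ r₂

  Run-cast : ∀ {T m n c c′ W} → m ≡ n → Run T m c c′ W → Run T n c c′ W
  Run-cast refl r = r

  positions-Run : ∀ {T n c c′ W} → Run T n c c′ W → positions T n c ≡ W ++ [ proj₁ c′ ]
  positions-Run []                              = refl
  positions-Run {T} (_∷_ {c = pos , s} st r) with act T pos (settle s) | st
  ... | just _ | refl = cong (pos ∷_) (positions-Run r)

  Run-settle : ∀ {T n pos s s′ c W} → settle s ≡ settle s′ → 1 ≤ n →
               Run T n (pos , s′) c W → Run T n (pos , s) c W
  Run-settle {T} {pos = pos} eq _ (st ∷ r) = trans (cong (act T pos) eq) st ∷ r

  module _ (T : PTree) where

    act-move : ∀ pos s {pos′ e} → move T pos (port s) ≡ just (pos′ , e) →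
               act T pos s ≡ just (pos′ , observe s e (deg T pos′))
    act-move pos s mv with move T pos (port s) | mv
    ... | just _ | refl = refl

    step-toChild : ∀ {k pos cs pp R j cs′ p′} → AtNode T pos cs pp → length R < D k →
                   lookupM cs j ≡ just (sub cs′ p′) →
                   step T (pos , ⟨ k ∣ (pp , j , length cs) ∣ R ⟩)
                     ≡ just (j ∷ pos , ⟨ k ∣ (toℕ p′ , 0 , length cs′) ∣ (pp , suc j , length cs) ∷ R ⟩)
                   × AtNode T (j ∷ pos) cs′ (toℕ p′)
    step-toChild {k} {pos} {cs} {pp} {R} {j} {cs′} {p′} at R<D l = stepped , proj₂ moved
      where
      moved = move-toChild T pos j at l
      s = ⟨ k ∣ (pp , j , length cs) ∣ R ⟩
      down : descends s ≡ true
      down = cong₂ _∧_ (<⇒<ᵇ≡true R<D) (<⇒<ᵇ≡true (lookupM-< cs j l))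
      stepped : step T (pos , s)
                ≡ just (j ∷ pos , ⟨ k ∣ (toℕ p′ , 0 , length cs′) ∣ (pp , suc j , length cs) ∷ R ⟩)
      stepped rewrite settle-descends s down
                    | act-move pos s (trans (cong (λ b → move T pos (if b then portOf pp j else pp)) down) (proj₁ moved))
                    | down
                    | deg-AtNode T j pos (proj₂ moved) = refl

    step-toParent : ∀ {k i pos cs pp j f R} → AtNode T (i ∷ pos) cs pp →
                    descends ⟨ k ∣ (pp , j , length cs) ∣ f ∷ R ⟩ ≡ false →
                    step T (i ∷ pos , ⟨ k ∣ (pp , j , length cs) ∣ f ∷ R ⟩) ≡ just (pos , ⟨ k ∣ f ∣ R ⟩)
    step-toParent {k} {i} {pos} {cs} {pp} {j} {f} {R} at up
      rewrite act-move (i ∷ pos) ⟨ k ∣ (pp , j , length cs) ∣ f ∷ R ⟩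
                (trans (cong (λ b → move T (i ∷ pos) (if b then portOf pp j else pp)) up) (move-toParent T i pos at))
            | up = refl

    -- suf lists the children of index ≥ j of the node at pos, which lies at depth D k ∸ suc b.
    mutual
      exploreChildren : ∀ k b pos cs pp R j suf → AtNode T pos cs pp → length R + suc b ≡ D k →
                        j + length suf ≡ length cs → (∀ i → lookupM cs (j + i) ≡ lookupM suf i) →
                        ∃[ W ] Run T (2 * nodesUpTo (suc b) (shapeList suf))
                                     (pos , ⟨ k ∣ (pp , j , length cs) ∣ R ⟩)
                                     (pos , ⟨ k ∣ (pp , length cs , length cs) ∣ R ⟩) W
                             × (∀ i {c} fp {s} → lookupM suf i ≡ just c → descend c fp ≡ just s → length fp ≤ b →
                                  fp ʳ++ (j + i ∷ pos) ∈ W)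
      exploreChildren k b pos cs pp R j [] at D≡ j≡ _ with trans (sym (+-identityʳ j)) j≡
      ... | refl = [] , [] , λ _ _ ()
      exploreChildren k b pos cs pp R j (sub cs′ p′ ∷ suf) at D≡ j≡ suf≡
        with exploreSubtree k b pos cs pp R j cs′ p′ at D≡ (trans (cong (lookupM cs) (sym (+-identityʳ j))) (suf≡ 0))
           | exploreChildren k b pos cs pp R (suc j) suf at D≡ (trans (sym (+-suc j _)) j≡)
               (λ i → trans (cong (lookupM cs) (sym (+-suc j i))) (suf≡ (suc i)))
      ... | W₁ , r₁ , cov₁ | W₂ , r₂ , cov₂ =
        W₁ ++ W₂ , Run-cast (cost (nodesUpTo b (shapeList cs′)) _) (Run-++ r₁ r₂) , covered
        where
        cost : ∀ x y → 2 + 2 * x + 2 * y ≡ 2 * (suc x + y)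
        cost = solve-∀
        covered : ∀ i {c} fp {s} → lookupM (sub cs′ p′ ∷ suf) i ≡ just c → descend c fp ≡ just s → length fp ≤ b →
                  fp ʳ++ (j + i ∷ pos) ∈ W₁ ++ W₂
        covered zero    fp refl d le =
          ∈-++⁺ˡ (subst (λ x → fp ʳ++ (x ∷ pos) ∈ W₁) (sym (+-identityʳ j)) (cov₁ fp d le))
        covered (suc i) fp l    d le =
          ∈-++⁺ʳ W₁ (subst (λ x → fp ʳ++ (x ∷ pos) ∈ W₂) (sym (+-suc j i)) (cov₂ i fp l d le))

      exploreSubtree : ∀ k b pos cs pp R j cs′ p′ → AtNode T pos cs pp → length R + suc b ≡ D k →
                       lookupM cs j ≡ just (sub cs′ p′) →
                       ∃[ W ] Run T (2 + 2 * nodesUpTo b (shapeList cs′))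
                                    (pos , ⟨ k ∣ (pp , j , length cs) ∣ R ⟩)
                                    (pos , ⟨ k ∣ (pp , suc j , length cs) ∣ R ⟩) W
                            × (∀ fp {s} → descend (sub cs′ p′) fp ≡ just s → length fp ≤ b →
                                 fp ʳ++ (j ∷ pos) ∈ W)
      exploreSubtree k b pos cs pp R j cs′ p′ at D≡ l
        with step-toChild {k} {R = R} at (subst (length R <_) D≡ (m<m+n (length R) (s≤s z≤n))) l
      exploreSubtree k zero pos cs pp R j cs′ p′ at D≡ l | down , at′ =
        pos ∷ (j ∷ pos) ∷ [] , down ∷ up ∷ [] , λ { [] _ _ → there (here refl) ; (_ ∷ _) _ () }
        where
        up : step T (j ∷ pos , ⟨ k ∣ (toℕ p′ , 0 , length cs′) ∣ (pp , suc j , length cs) ∷ R ⟩)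
             ≡ just (pos , ⟨ k ∣ (pp , suc j , length cs) ∣ R ⟩)
        up = step-toParent at′
               (cong (_∧ (0 <ᵇ length cs′)) (≥⇒<ᵇ≡false (≤-reflexive (trans (sym D≡) (+-comm (length R) 1)))))
      exploreSubtree k (suc b) pos cs pp R j cs′ p′ at D≡ l | down , at′
        with exploreChildren k b (j ∷ pos) cs′ (toℕ p′) ((pp , suc j , length cs) ∷ R) 0 cs′ at′
               (trans (sym (+-suc (length R) (suc b))) D≡) refl (λ _ → refl)
      ... | W , r , cov =
        pos ∷ (W ++ (j ∷ pos) ∷ []) ,
        Run-cast (cong suc (+-comm (2 * nodesUpTo (suc b) (shapeList cs′)) 1))
              (down ∷ Run-++ r (up ∷ [])) ,
        covered
        where
        up : step T (j ∷ pos , ⟨ k ∣ (toℕ p′ , length cs′ , length cs′) ∣ (pp , suc j , length cs) ∷ R ⟩)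
             ≡ just (pos , ⟨ k ∣ (pp , suc j , length cs) ∣ R ⟩)
        up = step-toParent at′
               (trans (cong ((suc (length R) <ᵇ D k) ∧_) (≥⇒<ᵇ≡false (≤-refl {length cs′}))) (∧-zeroʳ _))
        covered : ∀ fp {s} → descend (sub cs′ p′) fp ≡ just s → length fp ≤ suc b →
                  fp ʳ++ (j ∷ pos) ∈ pos ∷ (W ++ (j ∷ pos) ∷ [])
        covered []       _ _ = there (∈-++⁺ʳ W (here refl))
        covered (i ∷ fp) d (s≤s le) with getSub-∷⁻ cs′ i fp d
        ... | _ , l′ , d′ = there (∈-++⁺ˡ (cov i fp l′ d′ le))

    start finish : ℕ → Config
    start  k = [] , ⟨ k ∣ (length T , 0 , length T) ∣ [] ⟩
    finish k = [] , ⟨ k ∣ (length T , length T , length T) ∣ [] ⟩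

    phase : ∀ k → 1 ≤ D k → ∃[ W ] Run T (2 * nodesUpTo (D k) (shapeList T)) (start k) (finish k) W × Covers T (D k) W
    phase k 1≤D with D k in D≡ | 1≤D
    ... | suc b | _ with exploreChildren k b [] T (length T) [] 0 T (refl , refl) (sym D≡) refl (λ _ → refl)
    ...   | W , run , cov = W , run , covers
      where
      fromPath : ∀ fp {s} → getSub T fp ≡ just s → length fp ≤ suc b → reverse fp ∈ W
      fromPath (i ∷ fp) at (s≤s le) with getSub-∷⁻ T i fp at
      ... | _ , l , d = cov i fp l d le
      covers : Covers T (suc b) W
      covers rp@(_ ∷ _) _ len node with Is-just⇒≡just node
      ... | _ , at = subst (_∈ W) (reverse-involutive rp)
                       (fromPath (reverse rp) at (subst (_≤ suc b) (sym (length-reverse rp)) len))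

    next-phase : ∀ K → 1 ≤ D (suc K) → 1 ≤ length T →
                 settle (proj₂ (finish K)) ≡ settle (proj₂ (start (suc K)))
    next-phase K 1≤D 1≤T
      rewrite ≥⇒<ᵇ≡false (≤-refl {length T}) | ∧-zeroʳ (0 <ᵇ D K) =
      sym (settle-descends (proj₂ (start (suc K))) (cong₂ _∧_ (<⇒<ᵇ≡true 1≤D) (<⇒<ᵇ≡true 1≤T)))

    module _ (a : ℕ) (T-nonempty : 1 ≤ length T) (D-pos : ∀ k → 1 ≤ D k)
             (D-small : ∀ k → nodesUpTo (D k) (shapeList T) ≤ a * 2 ^ k) where

      phases : ∀ K → ∃[ t ] ∃[ W ] Run T t (start 0) (finish K) W × t + 2 * a ≤ 4 * (a * 2 ^ K) × Covers T (D K) W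
      phases zero with phase 0 (D-pos 0)
      ... | W , run , cov = _ , W , run , cost , cov
        where
        open ≤-Reasoning
        N = nodesUpTo (D 0) (shapeList T)
        cost : 2 * N + 2 * a ≤ 4 * (a * 1)
        cost = begin
          2 * N + 2 * a       ≤⟨ +-monoˡ-≤ (2 * a) (*-monoʳ-≤ 2 (D-small 0)) ⟩
          2 * (a * 1) + 2 * a ≡⟨ regroup a ⟩
          4 * (a * 1)         ∎
          where
          regroup : ∀ a → 2 * (a * 1) + 2 * a ≡ 4 * (a * 1)
          regroup = solve-∀
      phases (suc K) with phases K | phase (suc K) (D-pos (suc K))
      ... | t , W , run , cost , _ | W′ , run′ , cov′ =
        t + 2 * N , W ++ W′ ,
        Run-++ run (Run-settle (next-phase K (D-pos (suc K)) T-nonempty)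
                      (≤-trans (nodesUpTo-pos (D (suc K)) T (D-pos (suc K)) T-nonempty) (m≤m+n N (N + 0))) run′) ,
        cost′ , λ rp 1≤ ≤D node → ∈-++⁺ʳ W (cov′ rp 1≤ ≤D node)
        where
        open ≤-Reasoning
        N = nodesUpTo (D (suc K)) (shapeList T)
        X = 2 ^ K
        cost′ : t + 2 * N + 2 * a ≤ 4 * (a * (2 * X))
        cost′ = begin
          t + 2 * N + 2 * a               ≡⟨ swap t (2 * N) (2 * a) ⟩
          (t + 2 * a) + 2 * N             ≤⟨ +-mono-≤ cost (*-monoʳ-≤ 2 (D-small (suc K))) ⟩
          4 * (a * X) + 2 * (a * (2 * X)) ≡⟨ doubled a X ⟩
          4 * (a * (2 * X))               ∎
          where
          swap : ∀ x y z → x + y + z ≡ x + z + y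
          swap = solve-∀
          doubled : ∀ a X → 4 * (a * X) + 2 * (a * (2 * X)) ≡ 4 * (a * (2 * X))
          doubled = solve-∀

-- The schedule and the cost of the search

depthBudget : List Shape → ℕ → ℕ → ℕ
depthBudget xs B zero    = 0
depthBudget xs B (suc H) with nodesUpTo (suc H) xs ≤? B
... | yes _ = suc H
... | no  _ = depthBudget xs B H

nodesUpTo-depthBudget : ∀ xs B H → nodesUpTo (depthBudget xs B H) xs ≤ B
nodesUpTo-depthBudget xs B zero    = z≤n
nodesUpTo-depthBudget xs B (suc H) with nodesUpTo (suc H) xs ≤? B
... | yes fits = fits
... | no  _    = nodesUpTo-depthBudget xs B H

depthBudget-maximal : ∀ xs B H {d} → d ≤ H → nodesUpTo d xs ≤ B → d ≤ depthBudget xs B H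
depthBudget-maximal xs B zero    d≤H _    = d≤H
depthBudget-maximal xs B (suc H) d≤H fits with nodesUpTo (suc H) xs ≤? B
... | yes _       = d≤H
... | no  too-big with m≤n⇒m<n∨m≡n d≤H
...   | inj₁ (s≤s d≤H′) = depthBudget-maximal xs B H d≤H′ fits
...   | inj₂ refl       = ⊥-elim (too-big fits)

schedule : Shape → ℕ → ℕ
schedule S k = depthBudget (children S) (rootDegree S * 2 ^ k) (hS S)

explore : Shape → Strategy
explore S = IDFS.strategy (schedule S)

schedule-pos : ∀ S → 1 ≤ hS S → ∀ k → 1 ≤ schedule S k
schedule-pos S 1≤h k = depthBudget-maximal (children S) (rootDegree S * 2 ^ k) (hS S) 1≤h (begin
  rootDegree S           ≡⟨ *-identityʳ (rootDegree S) ⟨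
  rootDegree S * 1       ≤⟨ *-monoʳ-≤ (rootDegree S) (m^n>0 2 k) ⟩
  rootDegree S * 2 ^ k   ∎)
  where open ≤-Reasoning

n≤2^n : ∀ n → n ≤ 2 ^ n
n≤2^n zero    = z≤n
n≤2^n (suc n) = +-mono-≤ (m^n>0 2 n) (≤-trans (n≤2^n n) (m≤m+n (2 ^ n) 0))

doubling-below : ∀ a n K → n ≤ a * 2 ^ K → ∃[ K′ ] n ≤ a * 2 ^ K′ × a * 2 ^ K′ ≤ a + 2 * n
doubling-below a n zero    n≤ = 0 , n≤ , ≤-trans (≤-reflexive (*-identityʳ a)) (m≤m+n a (2 * n))
doubling-below a n (suc K) n≤ with n ≤? a * 2 ^ K
... | yes n≤′ = doubling-below a n K n≤′
... | no  n≰  = suc K , n≤ , (begin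
  a * (2 * 2 ^ K) ≡⟨ x*[2*y]≡2*[x*y] a (2 ^ K) ⟩
  2 * (a * 2 ^ K) ≤⟨ *-monoʳ-≤ 2 (<⇒≤ (≰⇒> n≰)) ⟩
  2 * n           ≤⟨ m≤n+m (2 * n) a ⟩
  a + 2 * n       ∎)
  where
  open ≤-Reasoning
  x*[2*y]≡2*[x*y] : ∀ x y → x * (2 * y) ≡ 2 * (x * y)
  x*[2*y]≡2*[x*y] = solve-∀

doubling : ∀ a n → 1 ≤ a → ∃[ K ] n ≤ a * 2 ^ K × a * 2 ^ K ≤ a + 2 * n
doubling a n 1≤a = doubling-below a n n (begin
  n         ≤⟨ n≤2^n n ⟩
  2 ^ n     ≡⟨ *-identityˡ (2 ^ n) ⟨
  1 * 2 ^ n ≤⟨ *-monoˡ-≤ (2 ^ n) 1≤a ⟩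
  a * 2 ^ n ∎)
  where open ≤-Reasoning

explore-cost : ∀ S T d → shape T ≅ S → 1 ≤ d → d ≤ hS S →
               ∃[ t ] t ≤ 2 * rootDegree S + 8 * nodesUpTo d (children S) × Done (explore S) T d t
explore-cost S T d T≅S 1≤d d≤h
  with doubling (rootDegree S) (nodesUpTo d (children S)) (rootDegree-pos S (≤-trans 1≤d d≤h))
... | K , n≤ , ≤a+2n
  with IDFS.phases (schedule S) T (rootDegree S)
         (≅-nonempty T T≅S (≤-trans 1≤d d≤h)) (schedule-pos S (≤-trans 1≤d d≤h))
         (λ k → subst (_≤ rootDegree S * 2 ^ k) (sym (nodesUpTo-≅ (schedule S k) T≅S))
                      (nodesUpTo-depthBudget (children S) (rootDegree S * 2 ^ k) (hS S)))
         K
... | t , W , run , t+2a≤ , covers = t , +-cancelʳ-≤ (2 * a) t (2 * a + 8 * n) t+2a≤′ , done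
  where
  open IDFS (schedule S)
  a = rootDegree S
  n = nodesUpTo d (children S)
  t+2a≤′ : t + 2 * a ≤ 2 * a + 8 * n + 2 * a
  t+2a≤′ = begin
    t + 2 * a             ≤⟨ t+2a≤ ⟩
    4 * (a * 2 ^ K)       ≤⟨ *-monoʳ-≤ 4 ≤a+2n ⟩
    4 * (a + 2 * n)       ≡⟨ expand a n ⟩
    2 * a + 8 * n + 2 * a ∎
    where
    open ≤-Reasoning
    expand : ∀ a n → 4 * (a + 2 * n) ≡ 2 * a + 8 * n + 2 * a
    expand = solve-∀
  done : Done (explore S) T d t
  done rp refl node = subst (rp ∈_) (sym (trans (exec≡positions T t [] (length T , [])) (positions-Run run)))
    (∈-++⁺ˡ (covers rp 1≤d (depthBudget-maximal (children S) (a * 2 ^ K) (hS S) d≤h n≤) node))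

combine-bounds : ∀ t a n d den x → 1 ≤ d → t ≤ 2 * a + 8 * n → a * den ≤ 1 * x → n * den ≤ d * x →
                 t * den ≤ 10 * d * x
combine-bounds t a n d den x 1≤d t≤ a≤ n≤ = begin
  t * den                       ≤⟨ *-monoˡ-≤ den t≤ ⟩
  (2 * a + 8 * n) * den         ≡⟨ distrib a n den ⟩
  2 * (a * den) + 8 * (n * den) ≤⟨ +-mono-≤ (*-monoʳ-≤ 2 (≤-trans a≤ (*-monoˡ-≤ x 1≤d))) (*-monoʳ-≤ 8 n≤) ⟩
  2 * (d * x) + 8 * (d * x)     ≡⟨ collect d x ⟩
  10 * d * x                    ∎
  where
  open ≤-Reasoning
  distrib : ∀ a n den → (2 * a + 8 * n) * den ≡ 2 * (a * den) + 8 * (n * den)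
  distrib = solve-∀
  collect : ∀ d x → 2 * (d * x) + 8 * (d * x) ≡ 10 * d * x
  collect = solve-∀

-- What the three pairs K₁ ≪ K₂ have in common: a K₂-knowledge reveals the shape of the tree, and
-- with each instance (T , d) it contains a K₁-knowledge of (T , j) for every 1 ≤ j ≤ d.
record Refines (K₁ K₂ : KType) : Set₁ where
  field
    shapeOf   : Param K₂ → Shape
    mem-shape : ∀ {k₂ T d} → Mem K₂ k₂ T d → shape T ≅ shapeOf k₂
    mem-depth : ∀ {k₂ T d} → Mem K₂ k₂ T d → 1 ≤ d × d ≤ hS (shapeOf k₂)
    restrict  : ∀ {k₂ T d j} → Mem K₂ k₂ T d → 1 ≤ j → j ≤ d →
                ∃[ k₁ ] Mem K₁ k₁ T j × (∀ T′ d′ → Mem K₁ k₁ T′ d′ → Mem K₂ k₂ T′ d′)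

penalty-linear : ∀ {K₁ K₂} → Refines K₁ K₂ → PenO K₁ K₂ (λ m → m)
penalty-linear {K₁} {K₂} refines = 10 , s≤s z≤n , (λ k₂ → explore (shapeOf k₂)) , bound
  where
  open Refines refines
  bound : ∀ (A₁ : Alg K₁) k₂ m → 1 ≤ m → ∀ num den → 1 ≤ den →
          (∀ k₁ → (∀ T d → Mem K₁ k₁ T d → Mem K₂ k₂ T d) → OverheadLe K₁ A₁ k₁ m num den) →
          OverheadLe K₂ (λ k₂ → explore (shapeOf k₂)) k₂ m (10 * m * num) den
  bound A₁ k₂ m _ num den _ optimal T d T∈ d≤m
    with explore-cost (shapeOf k₂) T d (mem-shape T∈) (proj₁ (mem-depth T∈)) (proj₂ (mem-depth T∈))
  ... | t , t≤ , done = t , subst (t * den ≤_) (reorder d num m) cost , done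
    where
    1≤d = proj₁ (mem-depth T∈)
    levels : ∀ j → 1 ≤ j → j ≤ d → length (level j T) * den ≤ num * m
    levels j 1≤j j≤d with restrict T∈ 1≤j j≤d
    ... | k₁ , Tj∈ , k₁⊆k₂ with optimal k₁ k₁⊆k₂ T j Tj∈ (≤-trans j≤d d≤m)
    ...   | tⱼ , tⱼ≤ , doneⱼ =
      levelSize-bound (A₁ k₁) T {t = tⱼ} {num = num} 1≤j (≤-trans j≤d d≤m) tⱼ≤ doneⱼ
    nodesUpTo-bound′ : ∀ b → b ≤ d → nodesUpTo b (children (shapeOf k₂)) * den ≤ b * (num * m)
    nodesUpTo-bound′ b b≤d = subst (λ x → x * den ≤ b * (num * m)) (nodesUpTo-≅ b (mem-shape T∈))
      (nodesUpTo-bound T b den (num * m) (λ j 1≤j j≤b → levels j 1≤j (≤-trans j≤b b≤d)))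
    cost : t * den ≤ 10 * d * (num * m)
    cost = combine-bounds t (rootDegree (shapeOf k₂)) (nodesUpTo d (children (shapeOf k₂))) d den (num * m) 1≤d t≤
             (nodesUpTo-bound′ 1 1≤d) (nodesUpTo-bound′ d ≤-refl)
    reorder : ∀ d num m → 10 * d * (num * m) ≡ 10 * m * num * d
    reorder = solve-∀

compDist-compNodist : Refines compDist compNodist
compDist-compNodist = record
  { shapeOf   = shape
  ; mem-shape = λ { (refl , _) → ≅-refl }
  ; mem-depth = proj₂
  ; restrict  = λ { {T} (refl , _ , d≤h) 1≤j j≤d →
      let j≤h = ≤-trans j≤d d≤h in
      ((T , _) , 1≤j , j≤h) , (refl , refl) , λ { _ _ (refl , refl) → refl , 1≤j , j≤h } }
  }

blindDist-blindNodist : Refines blindDist blindNodist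
blindDist-blindNodist = record
  { shapeOf   = λ S → S
  ; mem-shape = proj₁
  ; mem-depth = proj₂
  ; restrict  = λ { {S} (T≅S , _ , d≤h) 1≤j j≤d →
      let j≤h = ≤-trans j≤d d≤h in
      ((S , _) , 1≤j , j≤h) , (T≅S , refl) , λ { _ _ (T′≅S , refl) → T′≅S , 1≤j , j≤h } }
  }

compDist-blindNodist : Refines compDist blindNodist
compDist-blindNodist = record
  { shapeOf   = λ S → S
  ; mem-shape = proj₁
  ; mem-depth = proj₂
  ; restrict  = λ { {T = T} (T≅S , _ , d≤h) 1≤j j≤d →
      let j≤h = ≤-trans j≤d d≤h in
      ((T , _) , 1≤j , subst (_ ≤_) (sym (hS-≅ T≅S)) j≤h) , (refl , refl) ,
      λ { _ _ (refl , refl) → T≅S , 1≤j , j≤h } }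
  }

lemma3p1 : PenO compDist compNodist (λ m → m)
         × PenO blindDist blindNodist (λ m → m)
         × PenO compDist blindNodist (λ m → m)
lemma3p1 = penalty-linear compDist-compNodist , penalty-linear blindDist-blindNodist , penalty-linear compDist-blindNodist
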